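{- Let $Y$ be a string and $K \ge 0$ an integer, and write $Y_s = Y[K+s \,..\, |Y|-K+s)$. If $Y$ is periodic with primitive period $P$ and $|Y| \ge |P|^2 + 2K$, then for all $s, s' \in \{ -K, \dots, K\}$: \[ \mathrm{ED}(Y_s, Y_{s'}) = 2 \cdot \min_{j \in \mathbb Z} \big|\, s - s' + j|P| \,\big|. \]
   Context: Strings are indexed from $0$; $Y[i..j)$ denotes the substring $Y[i]Y[i+1]\cdots Y[j-1]$. $\mathrm{ED}$ is the edit distance (minimum number of insertions, deletions, substitutions). For a string $P$, $P^*$ is the infinite string obtained by repeating $P$; $Y$ is periodic with period $P$ if $Y = P^*[0..|Y|)$. Two equal-length strings $X,Y$ are rotations of each other if $X[i] = Y[(i+s) \bmod |Y|]$ for some integer $s$ and all $i$; $P$ is primitive if no nontrivial rotation of $P$ equals $P$. -}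

module Defs where

open import Data.Nat using (ℕ; zero; suc; _+_; _*_; _∸_; _≤_; _<_)
open import Data.Nat.DivMod using (_%_)
open import Data.Integer as ℤ using (ℤ; +_; ∣_∣)
open import Data.List using (List; []; _∷_; _++_; length; take; drop)
open import Data.Maybe using (Maybe; just; nothing)
open import Data.Product using (Σ; _×_; ∃; ∃-syntax)
open import Relation.Binary.PropositionalEquality using (_≡_)

-- Strings over an alphabet A are lists; indices start at 0.

_!?_ : {A : Set} → List A → ℕ → Maybe A
[]       !? _       = nothing
(x ∷ xs) !? zero    = just x
(x ∷ xs) !? (suc i) = xs !? i

-- m mod n (with m mod 0 = m; only used with n = |P| ≥ 1 where relevant)
_mod_ : ℕ → ℕ → ℕ
m mod zero    = m
m mod (suc n) = m % suc n

substr : {A : Set} → List A → ℕ → ℕ → List A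
substr Y i j = take (j ∸ i) (drop i Y)

-- Y_s = Y[K+s .. |Y|-K+s)  (for -K ≤ s ≤ K and |Y| ≥ 2K both ends are ≥ 0)
shiftWin : {A : Set} → List A → ℕ → ℤ → List A
shiftWin Y K s = substr Y ∣ + K ℤ.+ s ∣ ∣ (+ length Y ℤ.- + K) ℤ.+ s ∣

Periodic : {A : Set} → List A → List A → Set
Periodic Y P = ∀ i → i < length Y → Y !? i ≡ P !? (i mod length P)

IsRotation : {A : Set} → List A → List A → ℕ → Set
IsRotation X Y s = length X ≡ length Y × (∀ i → i < length Y → X !? i ≡ Y !? ((i + s) mod length Y))

Primitive : {A : Set} → List A → Set
Primitive P = ∀ s → IsRotation P P s → s mod length P ≡ 0

data Step {A : Set} : List A → List A → Set where
  ins : ∀ u v a   → Step (u ++ v) (u ++ a ∷ v)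
  del : ∀ u v a   → Step (u ++ a ∷ v) (u ++ v)
  sub : ∀ u v a b → Step (u ++ a ∷ v) (u ++ b ∷ v)

data Steps {A : Set} : ℕ → List A → List A → Set where
  done : ∀ {X} → Steps 0 X X
  step : ∀ {k X Y Z} → Step X Y → Steps k Y Z → Steps (suc k) X Z

IsED : {A : Set} → List A → List A → ℕ → Set
IsED X Y d = Steps d X Y × (∀ k → Steps k X Y → d ≤ k)

IsMinℤ : (ℤ → ℕ) → ℕ → Set
IsMinℤ f m = (∃[ j ] f j ≡ m) × (∀ j → m ≤ f j)

{-# OPTIONS --safe #-}
module Submission where

-- Y_s and Y_s′ are factors of P^* of the same length n ≥ |P|², starting at offsets K + s and K + s′.
-- Deleting r letters in front and appending r letters at the end moves the offset by r, so the
-- edit distance is at most 2 min_j |s − s′ + j|P||. Conversely, an alignment of cost c < |P| cannot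
-- touch all |P| disjoint blocks of length |P| of Y_s; an untouched block W occurs in Y_s at some i
-- and in Y_s′ at some j, and since P is primitive, W pins down its offset in P^* modulo |P|, so
-- s − s′ + i − j is a multiple of |P|. The parts before and after W differ in length by |i − j|,
-- which the alignment pays for on both sides: c ≥ 2|i − j|. Alignments of cost c ≥ |P| are no
-- better, because the minimum is at most |P|/2.

open import Defs
open import Data.Nat using (ℕ; _+_; _*_; _≥_)
open import Data.Integer as ℤ using (ℤ; +_; -_; ∣_∣)
open import Data.List using (List; length)
open import Data.Product using (_×_; ∃-syntax)

open import Data.Nat using (zero; suc; _∸_; _≤_; _<_; _⊓_; ∣_-_∣; z≤n; s≤s; s≤s⁻¹; NonZero; _≤?_)
open import Data.Nat.Properties
open import Algebra.Properties.CommutativeSemigroup +-commutativeSemigroup using (x∙yz≈y∙xz)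
open import Data.Nat.DivMod using (_%_; _/_; %-distribˡ-+; m%n%n≡m%n; [m+n]%n≡m%n; [m+kn]%n≡m%n;
  n%n≡0; m%n<n; m<n⇒m%n≡m)
open import Data.Integer using (-[1+_]; _⊖_)
open import Data.Integer.DivMod using (_%ℕ_; _/ℕ_; n%ℕd<d; a≡a%ℕn+[a/ℕn]*n)
import Data.Integer.Properties as ℤ
open import Data.Integer.Tactic.RingSolver using (solve-∀)
open import Data.List using ([]; _∷_; _++_; take; drop)
open import Data.List.Properties using (++-identityʳ; ++-assoc; length-++; length-take; length-drop; take++drop≡id)
open import Data.Maybe using (Maybe)
open import Data.Product using (_,_; proj₁; proj₂)
open import Data.Sum using (_⊎_; inj₁; inj₂)
open import Relation.Nullary using (yes; no)
open import Relation.Binary.PropositionalEquality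

private variable
  A : Set
  P U V X Z : List A
  c k l m n α β : ℕ

-- Indexing

!?-ext : length U ≡ length V → (∀ i → i < length U → U !? i ≡ V !? i) → U ≡ V
!?-ext {U = []}    {V = []}    _       _    = refl
!?-ext {U = x ∷ U} {V = y ∷ V} |U|≡|V| same with same 0 (s≤s z≤n)
... | refl = cong (x ∷_) (!?-ext (suc-injective |U|≡|V|) (λ i i<|U| → same (suc i) (s≤s i<|U|)))

!?-take : ∀ (U : List A) {n i} → i < n → take n U !? i ≡ U !? i
!?-take []      {suc n}              _         = refl
!?-take (x ∷ U) {suc n} {zero}       _         = refl
!?-take (x ∷ U) {suc n} {suc i}      (s≤s i<n) = !?-take U i<n

!?-drop : ∀ (U : List A) n i → drop n U !? i ≡ U !? (n + i)
!?-drop U       zero    i = refl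
!?-drop []      (suc n) i = refl
!?-drop (x ∷ U) (suc n) i = !?-drop U n i

!?-++ˡ : ∀ (U V : List A) {i} → i < length U → (U ++ V) !? i ≡ U !? i
!?-++ˡ (x ∷ U) V {zero}  _         = refl
!?-++ˡ (x ∷ U) V {suc i} (s≤s i<n) = !?-++ˡ U V i<n

!?-++ʳ : ∀ (U V : List A) i → (U ++ V) !? (length U + i) ≡ V !? i
!?-++ʳ []      V i = refl
!?-++ʳ (x ∷ U) V i = !?-++ʳ U V i

length-take-≤ : ∀ (U : List A) → n ≤ length U → length (take n U) ≡ n
length-take-≤ {n = n} U n≤|U| = trans (length-take n U) (m≤n⇒m⊓n≡m n≤|U|)

-- Edit scripts and alignments

steps-trans : Steps k U V → Steps l V X → Steps (k + l) U X
steps-trans done       t = t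
steps-trans (step s r) t = step s (steps-trans r t)

step-sym : Step U V → Step V U
step-sym (ins u v a)   = del u v a
step-sym (del u v a)   = ins u v a
step-sym (sub u v a b) = sub u v b a

steps-sym : Steps k U V → Steps k V U
steps-sym done = done
steps-sym {k = suc k} {U = U} {V = V} (step s r) =
  subst (λ c → Steps c V U) (+-comm k 1) (steps-trans (steps-sym r) (step (step-sym s) done))

steps-delete : ∀ (U X W : List A) → Steps (length X) (U ++ X ++ W) (U ++ W)
steps-delete U []      W = done
steps-delete U (x ∷ X) W = step (del U (X ++ W) x) (steps-delete U X W)

steps-rotate : ∀ (X Z X′ : List A) → Steps (length X + length X′) (X ++ Z) (Z ++ X′)
steps-rotate X Z X′ = steps-trans (steps-delete [] X Z)
  (subst₂ (Steps _) (++-identityʳ Z) (cong (Z ++_) (++-identityʳ X′)) (steps-sym (steps-delete Z X′ [])))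

steps-shift : length U ≡ n → length V ≡ n → m ≤ n
  → (∀ i → i + m < n → U !? (m + i) ≡ V !? i) → Steps (2 * m) U V
steps-shift {U = U} {n = n} {V = V} {m = m} |U| |V| m≤n shifted =
  subst₂ (λ c Y → Steps c Y V) cost (take++drop≡id m U)
    (subst (Steps _ (take m U ++ drop m U)) (trans (cong (_++ drop (n ∸ m) V) common) (take++drop≡id (n ∸ m) V))
      (steps-rotate (take m U) (drop m U) (drop (n ∸ m) V)))
  where
  |drop| : length (drop m U) ≡ n ∸ m
  |drop| = trans (length-drop m U) (cong (_∸ m) |U|)
  |take| : length (take (n ∸ m) V) ≡ n ∸ m
  |take| = length-take-≤ V (subst (n ∸ m ≤_) (sym |V|) (m∸n≤m n m))
  common : drop m U ≡ take (n ∸ m) V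
  common = !?-ext (trans |drop| (sym |take|)) λ i i<|drop| →
    let i<n∸m = subst (i <_) |drop| i<|drop| in begin
      drop m U !? i          ≡⟨ !?-drop U m i ⟩
      U !? (m + i)           ≡⟨ shifted i (m≤o∸n⇒m+n≤o (suc i) m≤n i<n∸m) ⟩
      V !? i                 ≡⟨ !?-take V i<n∸m ⟨
      take (n ∸ m) V !? i    ∎
    where open ≡-Reasoning
  cost : length (take m U) + length (drop (n ∸ m) V) ≡ 2 * m
  cost = cong₂ _+_ (length-take-≤ U (subst (m ≤_) (sym |U|) m≤n))
           (trans (length-drop (n ∸ m) V) (trans (cong (_∸ (n ∸ m)) |V|) (trans (m∸[m∸n]≡n m≤n) (sym (+-identityʳ m)))))

data Align {A : Set} : ℕ → List A → List A → Set where
  nil     : Align 0 [] []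
  match   : ∀ {c U V} x   → Align c U V → Align c (x ∷ U) (x ∷ V)
  replace : ∀ {c U V} x y → Align c U V → Align (suc c) (x ∷ U) (y ∷ V)
  delete  : ∀ {c U V} x   → Align c U V → Align (suc c) (x ∷ U) V
  insert  : ∀ {c U V} y   → Align c U V → Align (suc c) U (y ∷ V)
  weaken  : ∀ {c U V}     → Align c U V → Align (suc c) U V

align-refl : ∀ (U : List A) → Align 0 U U
align-refl []      = nil
align-refl (x ∷ U) = match x (align-refl U)

step⇒align : Step U V → Align 1 U V
step⇒align (ins []      v a)   = insert a (align-refl v)
step⇒align (del []      v a)   = delete a (align-refl v)
step⇒align (sub []      v a b) = replace a b (align-refl v)
step⇒align (ins (x ∷ u) v a)   = match x (step⇒align (ins u v a))
step⇒align (del (x ∷ u) v a)   = match x (step⇒align (del u v a))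
step⇒align (sub (x ∷ u) v a b) = match x (step⇒align (sub u v a b))

align-+-suc : ∀ a {b} → Align (suc (a + b)) U V → Align (a + suc b) U V
align-+-suc {U = U} {V = V} a {b} = subst (λ c → Align c U V) (sym (+-suc a b))

align-trans : ∀ {a b} → Align a U V → Align b V X → Align (a + b) U X
align-trans {a = a} f (insert y g)           = align-+-suc a (insert y (align-trans f g))
align-trans {a = a} f (weaken g)             = align-+-suc a (weaken (align-trans f g))
align-trans (delete x f)    g                = delete x (align-trans f g)
align-trans (weaken f)      g                = weaken (align-trans f g)
align-trans nil             nil              = nil
align-trans (match x f)     (match _ g)      = match x (align-trans f g)
align-trans {a = a} (match x f) (replace _ y g) = align-+-suc a (replace x y (align-trans f g))
align-trans {a = a} (match x f) (delete _ g)    = align-+-suc a (delete x (align-trans f g))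
align-trans (replace x y f) (match _ g)      = replace x y (align-trans f g)
align-trans {a = suc a} (replace x y f) (replace _ z g) = weaken (align-+-suc a (replace x z (align-trans f g)))
align-trans {a = suc a} (replace x y f) (delete _ g)    = weaken (align-+-suc a (delete x (align-trans f g)))
align-trans (insert y f)    (match _ g)      = insert y (align-trans f g)
align-trans {a = suc a} (insert y f) (replace _ z g) = weaken (align-+-suc a (insert z (align-trans f g)))
align-trans {a = suc a} (insert y f) (delete _ g)    = weaken (align-+-suc a (weaken (align-trans f g)))

steps⇒align : Steps k U V → Align k U V
steps⇒align {U = U} done = align-refl U
steps⇒align (step s r)   = align-trans (step⇒align s) (steps⇒align r)

align-0⇒≡ : Align 0 U V → U ≡ V
align-0⇒≡ nil         = refl
align-0⇒≡ (match x f) = cong (x ∷_) (align-0⇒≡ f)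

∣1+m-n∣≤1+∣m-n∣ : ∀ m n → ∣ suc m - n ∣ ≤ suc ∣ m - n ∣
∣1+m-n∣≤1+∣m-n∣ zero    zero    = ≤-refl
∣1+m-n∣≤1+∣m-n∣ zero    (suc n) = ≤-trans (n≤1+n n) (n≤1+n (suc n))
∣1+m-n∣≤1+∣m-n∣ (suc m) zero    = ≤-refl
∣1+m-n∣≤1+∣m-n∣ (suc m) (suc n) = ∣1+m-n∣≤1+∣m-n∣ m n

∣m-1+n∣≤1+∣m-n∣ : ∀ m n → ∣ m - suc n ∣ ≤ suc ∣ m - n ∣
∣m-1+n∣≤1+∣m-n∣ m n = subst₂ (λ x y → x ≤ suc y) (∣-∣-comm (suc n) m) (∣-∣-comm n m) (∣1+m-n∣≤1+∣m-n∣ n m)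

align-length : Align c U V → ∣ length U - length V ∣ ≤ c
align-length nil                       = z≤n
align-length (match x f)               = align-length f
align-length (replace x y f)           = m≤n⇒m≤1+n (align-length f)
align-length {U = _ ∷ U} {V} (delete x f) =
  ≤-trans (∣1+m-n∣≤1+∣m-n∣ (length U) (length V)) (s≤s (align-length f))
align-length {U = U} {_ ∷ V} (insert y f) =
  ≤-trans (∣m-1+n∣≤1+∣m-n∣ (length U) (length V)) (s≤s (align-length f))
align-length (weaken f)                = m≤n⇒m≤1+n (align-length f)

align-++ : ∀ {a b U′ V′} → Align a U V → Align b U′ V′ → Align (a + b) (U ++ U′) (V ++ V′)
align-++ nil             g = g
align-++ (match x f)     g = match x (align-++ f g)
align-++ (replace x y f) g = replace x y (align-++ f g)
align-++ (delete x f)    g = delete x (align-++ f g)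
align-++ (insert y f)    g = insert y (align-++ f g)
align-++ (weaken f)      g = weaken (align-++ f g)

record AlignSplit {A : Set} (c : ℕ) (U₁ U₂ V : List A) : Set where
  constructor split
  field
    V₁ V₂ : List A
    c₁ c₂ : ℕ
    V≡    : V ≡ V₁ ++ V₂
    align₁ : Align c₁ U₁ V₁
    align₂ : Align c₂ U₂ V₂
    cost  : c₁ + c₂ ≡ c

align-split : ∀ (U₁ : List A) {U₂} → Align c (U₁ ++ U₂) V → AlignSplit c U₁ U₂ V
align-split [] f = split [] _ 0 _ refl nil f refl
align-split (x ∷ U₁) (match _ f) with align-split U₁ f
... | split V₁ V₂ c₁ c₂ refl f₁ f₂ refl = split (x ∷ V₁) V₂ c₁ c₂ refl (match x f₁) f₂ refl
align-split (x ∷ U₁) (replace _ y f) with align-split U₁ f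
... | split V₁ V₂ c₁ c₂ refl f₁ f₂ refl = split (y ∷ V₁) V₂ (suc c₁) c₂ refl (replace x y f₁) f₂ refl
align-split (x ∷ U₁) (delete _ f) with align-split U₁ f
... | split V₁ V₂ c₁ c₂ refl f₁ f₂ refl = split V₁ V₂ (suc c₁) c₂ refl (delete x f₁) f₂ refl
align-split (x ∷ U₁) (insert y f) with align-split (x ∷ U₁) f
... | split V₁ V₂ c₁ c₂ refl f₁ f₂ refl = split (y ∷ V₁) V₂ (suc c₁) c₂ refl (insert y f₁) f₂ refl
align-split (x ∷ U₁) (weaken f) with align-split (x ∷ U₁) f
... | split V₁ V₂ c₁ c₂ refl f₁ f₂ refl = split V₁ V₂ (suc c₁) c₂ refl (weaken f₁) f₂ refl

record UntouchedBlock {A : Set} (c p : ℕ) (U V : List A) : Set where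
  constructor untouched
  field
    U₁ W U₂ V₁ V₂ : List A
    c₁ c₂ : ℕ
    U≡ : U ≡ U₁ ++ W ++ U₂
    V≡ : V ≡ V₁ ++ W ++ V₂
    |W|≡p : length W ≡ p
    align₁ : Align c₁ U₁ V₁
    align₂ : Align c₂ U₂ V₂
    cost : c₁ + c₂ ≡ c

-- Pigeonhole over the first q blocks of length p of U: every touched block costs at least 1.
untouched-block : ∀ q {p} → Align c U V → c < q → q * p ≤ length U → UntouchedBlock c p U V
untouched-block {U = U} (suc q) {p} f c<q qp≤|U|
  with align-split (take p U) (subst (λ X → Align _ X _) (sym (take++drop≡id p U)) f)
... | split V₁ V₂ zero c₂ refl f₁ f₂ refl =
  untouched [] (take p U) (drop p U) [] V₂ 0 c₂ (sym (take++drop≡id p U)) (cong (_++ V₂) (sym (align-0⇒≡ f₁)))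
    (length-take-≤ U (m+n≤o⇒m≤o p qp≤|U|)) nil f₂ refl
... | split V₁ V₂ (suc c₁) c₂ refl f₁ f₂ refl
  with untouched-block q f₂ (≤-trans (s≤s (m≤n+m c₂ c₁)) (s≤s⁻¹ c<q))
         (subst (q * p ≤_) (sym (length-drop p U)) (m+n≤o⇒m≤o∸n (q * p) (subst (_≤ length U) (+-comm p (q * p)) qp≤|U|)))
... | untouched U₁ W U₂ V₁′ V₂′ d₁ d₂ drop≡ refl |W| g₁ g₂ refl =
  untouched (take p U ++ U₁) W U₂ (V₁ ++ V₁′) V₂′ (suc c₁ + d₁) d₂
    (trans (sym (take++drop≡id p U)) (trans (cong (take p U ++_) drop≡) (sym (++-assoc (take p U) U₁ (W ++ U₂)))))
    (sym (++-assoc V₁ V₁′ (W ++ V₂′))) |W| (align-++ f₁ g₁) g₂ (+-assoc (suc c₁) d₁ d₂)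

-- Arithmetic modulo |P|

mod≡% : ∀ m n .{{_ : NonZero n}} → m mod n ≡ m % n
mod≡% m (suc n) = refl

[m%d+n]%d≡[m+n]%d : ∀ m n d .{{_ : NonZero d}} → (m % d + n) % d ≡ (m + n) % d
[m%d+n]%d≡[m+n]%d m n d = begin
  (m % d + n) % d           ≡⟨ %-distribˡ-+ (m % d) n d ⟩
  (m % d % d + n % d) % d   ≡⟨ cong (λ x → (x + n % d) % d) (m%n%n≡m%n m d) ⟩
  (m % d + n % d) % d       ≡⟨ %-distribˡ-+ m n d ⟨
  (m + n) % d               ∎
  where open ≡-Reasoning

[m+n%d]%d≡[m+n]%d : ∀ m n d .{{_ : NonZero d}} → (m + n % d) % d ≡ (m + n) % d
[m+n%d]%d≡[m+n]%d m n d = begin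
  (m + n % d) % d  ≡⟨ cong (_% d) (+-comm m (n % d)) ⟩
  (n % d + m) % d  ≡⟨ [m%d+n]%d≡[m+n]%d n m d ⟩
  (n + m) % d      ≡⟨ cong (_% d) (+-comm n m) ⟩
  (m + n) % d      ∎
  where open ≡-Reasoning

m%d≡n%d⇒[m+o]%d≡[n+o]%d : ∀ {m n} o {d} .{{_ : NonZero d}} → m % d ≡ n % d → (m + o) % d ≡ (n + o) % d
m%d≡n%d⇒[m+o]%d≡[n+o]%d {m} {n} o {d} eq = begin
  (m + o) % d      ≡⟨ [m%d+n]%d≡[m+n]%d m o d ⟨
  (m % d + o) % d  ≡⟨ cong (λ x → (x + o) % d) eq ⟩
  (n % d + o) % d  ≡⟨ [m%d+n]%d≡[m+n]%d n o d ⟩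
  (n + o) % d      ∎
  where open ≡-Reasoning

m%d≡n%d⇒+m≡+n+t*d : ∀ {m n d} .{{_ : NonZero d}} → m % d ≡ n % d → ∃[ t ] + m ≡ + n ℤ.+ t ℤ.* + d
m%d≡n%d⇒+m≡+n+t*d {m} {n} {d} eq = + (m / d) ℤ.- + (n / d) , (begin
  + m                                     ≡⟨ a≡a%ℕn+[a/ℕn]*n (+ m) d ⟩
  + (m % d) ℤ.+ + (m / d) ℤ.* + d         ≡⟨ cong (λ r → + r ℤ.+ + (m / d) ℤ.* + d) eq ⟩
  + (n % d) ℤ.+ + (m / d) ℤ.* + d         ≡⟨ regroup (+ (n % d)) (+ (m / d)) (+ (n / d)) (+ d) ⟩
  (+ (n % d) ℤ.+ + (n / d) ℤ.* + d) ℤ.+ (+ (m / d) ℤ.- + (n / d)) ℤ.* + d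
                                          ≡⟨ cong (ℤ._+ (+ (m / d) ℤ.- + (n / d)) ℤ.* + d) (a≡a%ℕn+[a/ℕn]*n (+ n) d) ⟨
  + n ℤ.+ (+ (m / d) ℤ.- + (n / d)) ℤ.* + d ∎)
  where
  open ≡-Reasoning
  regroup : ∀ r a b d → r ℤ.+ a ℤ.* d ≡ (r ℤ.+ b ℤ.* d) ℤ.+ (a ℤ.- b) ℤ.* d
  regroup = solve-∀

+m≡+n+t*d⇒m%d≡n%d : ∀ {m n d} .{{_ : NonZero d}} t → + m ≡ + n ℤ.+ t ℤ.* + d → m % d ≡ n % d
+m≡+n+t*d⇒m%d≡n%d {m} {n} {d} (+ k) eq = begin
  m % d            ≡⟨ cong (_% d) (ℤ.+-injective (trans eq (sym +[n+kd]))) ⟩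
  (n + k * d) % d  ≡⟨ [m+kn]%n≡m%n n k d ⟩
  n % d            ∎
  where
  open ≡-Reasoning
  +[n+kd] : + (n + k * d) ≡ + n ℤ.+ + k ℤ.* + d
  +[n+kd] = trans (ℤ.pos-+ n (k * d)) (cong (λ x → + n ℤ.+ x) (ℤ.pos-* k d))
+m≡+n+t*d⇒m%d≡n%d {m} {n} {d} -[1+ k ] eq =
  sym (+m≡+n+t*d⇒m%d≡n%d (+ suc k) (trans (cancel (+ n) -[1+ k ] (+ d)) (cong (ℤ._+ + suc k ℤ.* + d) (sym eq))))
  where
  cancel : ∀ a t d → a ≡ (a ℤ.+ t ℤ.* d) ℤ.+ (- t) ℤ.* d
  cancel = solve-∀

∣m⊖n∣≡∣m-n∣ : ∀ m n → ∣ m ⊖ n ∣ ≡ ∣ m - n ∣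
∣m⊖n∣≡∣m-n∣ zero    zero    = refl
∣m⊖n∣≡∣m-n∣ zero    (suc n) = refl
∣m⊖n∣≡∣m-n∣ (suc m) zero    = refl
∣m⊖n∣≡∣m-n∣ (suc m) (suc n) = trans (cong ∣_∣ (ℤ.[1+m]⊖[1+n]≡m⊖n m n)) (∣m⊖n∣≡∣m-n∣ m n)

offsets⇒distance : ∀ α β i j t p → + (α + i) ≡ + (β + j) ℤ.+ t ℤ.* p
  → ∣ (+ α ℤ.- + β) ℤ.+ (- t) ℤ.* p ∣ ≡ ∣ i - j ∣
offsets⇒distance α β i j t p eq = begin
  ∣ (+ α ℤ.- + β) ℤ.+ (- t) ℤ.* p ∣                                         ≡⟨ cong ∣_∣ (expand (+ α) (+ β) (+ i) (+ j) t p) ⟩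
  ∣ (+ j ℤ.- + i) ℤ.+ ((+ α ℤ.+ + i) ℤ.- ((+ β ℤ.+ + j) ℤ.+ t ℤ.* p)) ∣    ≡⟨ cong (λ x → ∣ (+ j ℤ.- + i) ℤ.+ (x ℤ.- y) ∣) eq′ ⟩
  ∣ (+ j ℤ.- + i) ℤ.+ (y ℤ.- y) ∣                                           ≡⟨ cong ∣_∣ (cancel (+ j ℤ.- + i) y) ⟩
  ∣ + j ℤ.- + i ∣                                                           ≡⟨ cong ∣_∣ (ℤ.m-n≡m⊖n j i) ⟩
  ∣ j ⊖ i ∣                                                                 ≡⟨ ∣m⊖n∣≡∣m-n∣ j i ⟩
  ∣ j - i ∣                                                                 ≡⟨ ∣-∣-comm j i ⟩
  ∣ i - j ∣                                                                 ∎
  where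
  open ≡-Reasoning
  y : ℤ
  y = (+ β ℤ.+ + j) ℤ.+ t ℤ.* p
  eq′ : + α ℤ.+ + i ≡ y
  eq′ = trans (sym (ℤ.pos-+ α i)) (trans eq (cong (ℤ._+ t ℤ.* p) (ℤ.pos-+ β j)))
  expand : ∀ a b i j t p → (a ℤ.- b) ℤ.+ (- t) ℤ.* p ≡ (j ℤ.- i) ℤ.+ ((a ℤ.+ i) ℤ.- ((b ℤ.+ j) ℤ.+ t ℤ.* p))
  expand = solve-∀
  cancel : ∀ x y → x ℤ.+ (y ℤ.- y) ≡ x
  cancel = solve-∀

distance⇒offsets : ∀ α β t p → ∣ (+ α ℤ.- + β) ℤ.+ t ℤ.* p ∣ ≡ m
  → + (β + m) ≡ + α ℤ.+ t ℤ.* p ⊎ + (α + m) ≡ + β ℤ.+ (- t) ℤ.* p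
distance⇒offsets {m = m} α β t p ∣x∣≡m with ℤ.+∣i∣≡i⊎+∣i∣≡-i ((+ α ℤ.- + β) ℤ.+ t ℤ.* p)
... | inj₁ +∣x∣≡x  = inj₁ (begin
  + (β + m)                                   ≡⟨ ℤ.pos-+ β m ⟩
  + β ℤ.+ + m                                 ≡⟨ cong (λ x → + β ℤ.+ x) (trans (cong +_ (sym ∣x∣≡m)) +∣x∣≡x) ⟩
  + β ℤ.+ ((+ α ℤ.- + β) ℤ.+ t ℤ.* p)         ≡⟨ cancel (+ α) (+ β) t p ⟩
  + α ℤ.+ t ℤ.* p                             ∎)
  where
  open ≡-Reasoning
  cancel : ∀ a b t p → b ℤ.+ ((a ℤ.- b) ℤ.+ t ℤ.* p) ≡ a ℤ.+ t ℤ.* p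
  cancel = solve-∀
... | inj₂ +∣x∣≡-x = inj₂ (begin
  + (α + m)                                   ≡⟨ ℤ.pos-+ α m ⟩
  + α ℤ.+ + m                                 ≡⟨ cong (λ x → + α ℤ.+ x) (trans (cong +_ (sym ∣x∣≡m)) +∣x∣≡-x) ⟩
  + α ℤ.+ - ((+ α ℤ.- + β) ℤ.+ t ℤ.* p)       ≡⟨ cancel (+ α) (+ β) t p ⟩
  + β ℤ.+ (- t) ℤ.* p                         ∎)
  where
  open ≡-Reasoning
  cancel : ∀ a b t p → a ℤ.+ - ((a ℤ.- b) ℤ.+ t ℤ.* p) ≡ b ℤ.+ (- t) ℤ.* p
  cancel = solve-∀

m+n≡o+q⇒∣m-o∣≡∣q-n∣ : ∀ {m n o q} → m + n ≡ o + q → ∣ m - o ∣ ≡ ∣ q - n ∣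
m+n≡o+q⇒∣m-o∣≡∣q-n∣ {m} {n} {o} {q} eq = begin
  ∣ m - o ∣          ≡⟨ ∣m+n-m+o∣≡∣n-o∣ n m o ⟨
  ∣ n + m - n + o ∣  ≡⟨ cong ∣_- n + o ∣ (trans (+-comm n m) eq) ⟩
  ∣ o + q - n + o ∣  ≡⟨ cong ∣ o + q -_∣ (+-comm n o) ⟩
  ∣ o + q - o + n ∣  ≡⟨ ∣m+n-m+o∣≡∣n-o∣ o q n ⟩
  ∣ q - n ∣          ∎
  where open ≡-Reasoning

r⊓[p∸r]≤∣r+k*p∣ : ∀ {r p} k → r ≤ p → r ⊓ (p ∸ r) ≤ ∣ + r ℤ.+ k ℤ.* + p ∣
r⊓[p∸r]≤∣r+k*p∣ {r} {p} (+ k) _ = begin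
  r ⊓ (p ∸ r)                  ≤⟨ m⊓n≤m r (p ∸ r) ⟩
  r                            ≤⟨ m≤m+n r (k * p) ⟩
  r + k * p                    ≡⟨ cong ∣_∣ (trans (ℤ.pos-+ r (k * p)) (cong (λ x → + r ℤ.+ x) (ℤ.pos-* k p))) ⟩
  ∣ + r ℤ.+ + k ℤ.* + p ∣      ∎
  where open ≤-Reasoning
r⊓[p∸r]≤∣r+k*p∣ {r} {p} -[1+ k ] r≤p =
  subst (r ⊓ e ≤_) (trans (sym (ℤ.∣-i∣≡∣i∣ (+ (e + k * p)))) (cong ∣_∣ (sym negative)))
    (≤-trans (m⊓n≤n r e) (m≤m+n e (k * p)))
  where
  open ≡-Reasoning
  e : ℕ
  e = p ∸ r
  +p≡+r++e : + p ≡ + r ℤ.+ + e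
  +p≡+r++e = trans (cong +_ (sym (m+[n∸m]≡n r≤p))) (ℤ.pos-+ r e)
  identity : ∀ a b c → a ℤ.+ (- (+ 1 ℤ.+ c)) ℤ.* (a ℤ.+ b) ≡ - (b ℤ.+ c ℤ.* (a ℤ.+ b))
  identity = solve-∀
  negative : + r ℤ.+ -[1+ k ] ℤ.* + p ≡ - + (e + k * p)
  negative = begin
    + r ℤ.+ -[1+ k ] ℤ.* + p               ≡⟨ cong (λ x → + r ℤ.+ -[1+ k ] ℤ.* x) +p≡+r++e ⟩
    + r ℤ.+ -[1+ k ] ℤ.* (+ r ℤ.+ + e)     ≡⟨ identity (+ r) (+ e) (+ k) ⟩
    - (+ e ℤ.+ + k ℤ.* (+ r ℤ.+ + e))      ≡⟨ cong (λ x → - (+ e ℤ.+ + k ℤ.* x)) +p≡+r++e ⟨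
    - (+ e ℤ.+ + k ℤ.* + p)                ≡⟨ cong -_ (trans (ℤ.pos-+ e (k * p)) (cong (λ x → + e ℤ.+ x) (ℤ.pos-* k p))) ⟨
    - + (e + k * p)                        ∎

nearest-multiple : ∀ d p .{{_ : NonZero p}} → ∃[ m ] IsMinℤ (λ j → ∣ d ℤ.+ j ℤ.* + p ∣) m × 2 * m ≤ p
nearest-multiple d p = r ⊓ (p ∸ r) , (attained , bounded) , 2m≤p
  where
  r : ℕ
  r = d %ℕ p
  q : ℤ
  q = d /ℕ p
  r≤p : r ≤ p
  r≤p = <⇒≤ (n%ℕd<d d p)
  regroup : ∀ r q j p → (r ℤ.+ q ℤ.* p) ℤ.+ j ℤ.* p ≡ r ℤ.+ (q ℤ.+ j) ℤ.* p
  regroup = solve-∀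
  shift : ∀ j → d ℤ.+ j ℤ.* + p ≡ + r ℤ.+ (q ℤ.+ j) ℤ.* + p
  shift j = trans (cong (ℤ._+ j ℤ.* + p) (a≡a%ℕn+[a/ℕn]*n d p)) (regroup (+ r) q j (+ p))
  bounded : ∀ j → r ⊓ (p ∸ r) ≤ ∣ d ℤ.+ j ℤ.* + p ∣
  bounded j = subst (r ⊓ (p ∸ r) ≤_) (cong ∣_∣ (sym (shift j))) (r⊓[p∸r]≤∣r+k*p∣ (q ℤ.+ j) r≤p)
  below : ∀ r q p → r ℤ.+ (q ℤ.+ - q) ℤ.* p ≡ r
  below = solve-∀
  above : ∀ r q p → r ℤ.+ (q ℤ.+ (- q ℤ.- + 1)) ℤ.* p ≡ r ℤ.- p
  above = solve-∀
  at-r : ∣ d ℤ.+ (- q) ℤ.* + p ∣ ≡ r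
  at-r = cong ∣_∣ (trans (shift (- q)) (below (+ r) q (+ p)))
  at-p∸r : ∣ d ℤ.+ (- q ℤ.- + 1) ℤ.* + p ∣ ≡ p ∸ r
  at-p∸r = trans (cong ∣_∣ (trans (shift (- q ℤ.- + 1)) (trans (above (+ r) q (+ p)) (trans (ℤ.m-n≡m⊖n r p) (ℤ.⊖-≤ r≤p)))))
             (ℤ.∣-i∣≡∣i∣ (+ (p ∸ r)))
  attained : ∃[ j ] ∣ d ℤ.+ j ℤ.* + p ∣ ≡ r ⊓ (p ∸ r)
  attained with ⊓-sel r (p ∸ r)
  ... | inj₁ r⊓≡r   = - q , trans at-r (sym r⊓≡r)
  ... | inj₂ r⊓≡p∸r = - q ℤ.- + 1 , trans at-p∸r (sym r⊓≡p∸r)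
  2m≤p : 2 * (r ⊓ (p ∸ r)) ≤ p
  2m≤p = ≤-trans (+-mono-≤ (m⊓n≤m r (p ∸ r)) (≤-trans (≤-reflexive (+-identityʳ _)) (m⊓n≤n r (p ∸ r))))
           (≤-reflexive (m+[n∸m]≡n r≤p))

-- Factors of P^*

_!*_ : (P : List A) .{{_ : NonZero (length P)}} → ℕ → Maybe A
P !* i = P !? (i % length P)

FactorAt : (P : List A) .{{_ : NonZero (length P)}} → ℕ → List A → Set
FactorAt P α X = ∀ i → i < length X → X !? i ≡ P !* (α + i)

primitive⇒NonZero : Primitive P → NonZero (length P)
primitive⇒NonZero {P = []} prim with () ← prim 1 (refl , λ _ ())
primitive⇒NonZero {P = _ ∷ _} _ = _

-- With w = |P| ∸ u % |P|, the hypothesis says that P is its own rotation by v + w.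
primitive⇒offsets-congruent : ∀ {u v} .{{_ : NonZero (length P)}} → Primitive P
  → (∀ r → r < length P → P !* (u + r) ≡ P !* (v + r)) → u % length P ≡ v % length P
primitive⇒offsets-congruent {P = P} {u} {v} prim agree = begin
  u % p                       ≡⟨ m%n%n≡m%n u p ⟨
  u % p % p                   ≡⟨ cong (_% p) (+-identityˡ (u % p)) ⟩
  (0 + u % p) % p             ≡⟨ cong (λ x → (x + u % p) % p) v+w≡0 ⟨
  ((v + w) % p + u % p) % p   ≡⟨ [m%d+n]%d≡[m+n]%d (v + w) (u % p) p ⟩
  (v + w + u % p) % p         ≡⟨ cong (_% p) (+-assoc v w (u % p)) ⟩
  (v + (w + u % p)) % p       ≡⟨ cong (λ x → (v + x) % p) (m∸n+n≡m (<⇒≤ (m%n<n u p))) ⟩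
  (v + p) % p                 ≡⟨ [m+n]%n≡m%n v p ⟩
  v % p                       ∎
  where
  open ≡-Reasoning
  p w : ℕ
  p = length P
  w = p ∸ u % p
  u+w≡0 : (u + w) % p ≡ 0
  u+w≡0 = trans (sym ([m%d+n]%d≡[m+n]%d u w p))
            (trans (cong (_% p) (m+[n∸m]≡n (<⇒≤ (m%n<n u p)))) (n%n≡0 p))
  reindex : ∀ x k → (x + (k + w) % p) % p ≡ (k + (x + w)) % p
  reindex x k = trans ([m+n%d]%d≡[m+n]%d x (k + w) p) (cong (_% p) (x∙yz≈y∙xz x k w))
  rotation : IsRotation P P (v + w)
  rotation = refl , λ k k<p → begin
    P !? k                          ≡⟨ cong (P !?_) (m<n⇒m%n≡m k<p) ⟨
    P !? (k % p)                    ≡⟨ cong (λ x → P !? (x % p)) (+-identityʳ k) ⟨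
    P !? ((k + 0) % p)              ≡⟨ cong (λ x → P !? ((k + x) % p)) u+w≡0 ⟨
    P !? ((k + (u + w) % p) % p)    ≡⟨ cong (P !?_) ([m+n%d]%d≡[m+n]%d k (u + w) p) ⟩
    P !? ((k + (u + w)) % p)        ≡⟨ cong (P !?_) (reindex u k) ⟨
    P !* (u + (k + w) % p)          ≡⟨ agree ((k + w) % p) (m%n<n (k + w) p) ⟩
    P !* (v + (k + w) % p)          ≡⟨ cong (P !?_) (reindex v k) ⟩
    P !? ((k + (v + w)) % p)        ≡⟨ cong (P !?_) (mod≡% (k + (v + w)) p) ⟨
    P !? ((k + (v + w)) mod p)      ∎
  v+w≡0 : (v + w) % p ≡ 0
  v+w≡0 = trans (sym (mod≡% (v + w) p)) (prim (v + w) rotation)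

module _ {A : Set} {P : List A} .{{_ : NonZero (length P)}} where

  factor-++ˡ : ∀ U V → FactorAt P α (U ++ V) → FactorAt P α U
  factor-++ˡ U V fac i i<|U| =
    trans (sym (!?-++ˡ U V i<|U|)) (fac i (≤-trans i<|U| (≤-trans (m≤m+n _ _) (≤-reflexive (sym (length-++ U))))))

  factor-++ʳ : ∀ U V → FactorAt P α (U ++ V) → FactorAt P (α + length U) V
  factor-++ʳ {α = α} U V fac i i<|V| = begin
    V !? i                      ≡⟨ !?-++ʳ U V i ⟨
    (U ++ V) !? (length U + i)  ≡⟨ fac (length U + i) (≤-trans (+-monoʳ-< (length U) i<|V|) (≤-reflexive (sym (length-++ U)))) ⟩
    P !* (α + (length U + i))   ≡⟨ cong (P !*_) (+-assoc α (length U) i) ⟨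
    P !* (α + length U + i)     ∎
    where open ≡-Reasoning

  factor-substring : ∀ {γ} → FactorAt P γ U → α + n ≤ length U
    → length (take n (drop α U)) ≡ n × FactorAt P (γ + α) (take n (drop α U))
  factor-substring {U = U} {α = α} {n = n} {γ} fac α+n≤|U| = |take| , factor
    where
    |take| : length (take n (drop α U)) ≡ n
    |take| = length-take-≤ (drop α U)
      (subst (n ≤_) (sym (length-drop α U)) (m+n≤o⇒m≤o∸n n (subst (_≤ length U) (+-comm α n) α+n≤|U|)))
    factor : FactorAt P (γ + α) (take n (drop α U))
    factor i i<|take| = begin
      take n (drop α U) !? i  ≡⟨ !?-take (drop α U) i<n ⟩
      drop α U !? i           ≡⟨ !?-drop U α i ⟩
      U !? (α + i)            ≡⟨ fac (α + i) (<-≤-trans (+-monoʳ-< α i<n) α+n≤|U|) ⟩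
      P !* (γ + (α + i))      ≡⟨ cong (P !*_) (+-assoc γ α i) ⟨
      P !* (γ + α + i)        ∎
      where
      open ≡-Reasoning
      i<n : i < n
      i<n = subst (i <_) |take| i<|take|

steps-lower-bound : .{{_ : NonZero (length P)}} → Primitive P → FactorAt P α X → FactorAt P β Z
  → length X ≡ length Z → length P * length P ≤ length X → Steps k X Z → k < length P
  → ∃[ t ] 2 * ∣ (+ α ℤ.- + β) ℤ.+ t ℤ.* + length P ∣ ≤ k
steps-lower-bound {P = P} {α = α} {β = β} prim facX facZ |X|≡|Z| pp st k<p
  with untouched-block (length P) (steps⇒align st) k<p pp
... | untouched U₁ W U₂ V₁ V₂ c₁ c₂ refl refl |W| f₁ f₂ refl = - t , (begin
  2 * ∣ (+ α ℤ.- + β) ℤ.+ (- t) ℤ.* + p ∣  ≡⟨ cong (2 *_) (offsets⇒distance α β i j t (+ p) offsets) ⟩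
  2 * ∣ i - j ∣                              ≤⟨ +-mono-≤ (align-length f₁) (≤-trans (≤-reflexive (+-identityʳ _)) ∣i-j∣≤c₂) ⟩
  c₁ + c₂                                    ∎)
  where
  open ≤-Reasoning
  p i j : ℕ
  p = length P
  i = length U₁
  j = length V₁
  W-at-i : FactorAt P (α + i) W
  W-at-i = factor-++ˡ {P = P} W U₂ (factor-++ʳ {P = P} U₁ (W ++ U₂) facX)
  W-at-j : FactorAt P (β + j) W
  W-at-j = factor-++ˡ {P = P} W V₂ (factor-++ʳ {P = P} V₁ (W ++ V₂) facZ)
  congruent : (α + i) % p ≡ (β + j) % p
  congruent = primitive⇒offsets-congruent {P = P} prim λ r r<p →
    let r<|W| = subst (r <_) (sym |W|) r<p in trans (sym (W-at-i r r<|W|)) (W-at-j r r<|W|)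
  t : ℤ
  t = proj₁ (m%d≡n%d⇒+m≡+n+t*d congruent)
  offsets : + (α + i) ≡ + (β + j) ℤ.+ t ℤ.* + p
  offsets = proj₂ (m%d≡n%d⇒+m≡+n+t*d congruent)
  lengths : i + (length W + length U₂) ≡ j + (length W + length V₂)
  lengths = trans (sym (trans (length-++ U₁) (cong (λ x → i + x) (length-++ W))))
              (trans |X|≡|Z| (trans (length-++ V₁) (cong (λ x → j + x) (length-++ W))))
  ∣i-j∣≤c₂ : ∣ i - j ∣ ≤ c₂
  ∣i-j∣≤c₂ = ≤-trans (≤-reflexive (begin-equality
    ∣ i - j ∣                                          ≡⟨ m+n≡o+q⇒∣m-o∣≡∣q-n∣ {i} {length W + length U₂} {j} lengths ⟩
    ∣ length W + length V₂ - length W + length U₂ ∣    ≡⟨ ∣m+n-m+o∣≡∣n-o∣ (length W) (length V₂) (length U₂) ⟩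
    ∣ length V₂ - length U₂ ∣                          ≡⟨ ∣-∣-comm (length V₂) (length U₂) ⟩
    ∣ length U₂ - length V₂ ∣                          ∎))
    (align-length f₂)

steps-upper-bound : .{{_ : NonZero (length P)}} → FactorAt P α X → FactorAt P β Z
  → length X ≡ n → length Z ≡ n → m ≤ n → ∀ t → + (α + m) ≡ + β ℤ.+ t ℤ.* + length P → Steps (2 * m) X Z
steps-upper-bound {P = P} {α = α} {X = X} {β = β} {Z = Z} {m = m} facX facZ |X| |Z| m≤n t eq =
  steps-shift |X| |Z| m≤n λ i i+m<n → begin
    X !? (m + i)          ≡⟨ facX (m + i) (subst₂ _<_ (+-comm i m) (sym |X|) i+m<n) ⟩
    P !* (α + (m + i))    ≡⟨ cong (P !?_) (trans (cong (_% length P) (sym (+-assoc α m i))) congruent) ⟩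
    P !* (β + i)          ≡⟨ facZ i (subst (i <_) (sym |Z|) (m+n≤o⇒m≤o (suc i) i+m<n)) ⟨
    Z !? i                ∎
  where
  open ≡-Reasoning
  congruent : ∀ {i} → (α + m + i) % length P ≡ (β + i) % length P
  congruent {i} = m%d≡n%d⇒[m+o]%d≡[n+o]%d i (+m≡+n+t*d⇒m%d≡n%d t eq)

factors-isED : .{{_ : NonZero (length P)}} → Primitive P → FactorAt P α X → FactorAt P β Z
  → length X ≡ n → length Z ≡ n → length P * length P ≤ n
  → IsMinℤ (λ j → ∣ (+ α ℤ.- + β) ℤ.+ j ℤ.* + length P ∣) m → 2 * m ≤ length P → IsED X Z (2 * m)
factors-isED {P = P} {α = α} {X = X} {β = β} {Z = Z} {n = n} {m = m}
  prim facX facZ |X| |Z| pp ((j , ∣x∣≡m) , minimal) 2m≤p = upper , lower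
  where
  p : ℕ
  p = length P
  m≤n : m ≤ n
  m≤n = ≤-trans (m≤m+n m (m + 0)) (≤-trans 2m≤p (≤-trans (m≤m*n p p) pp))
  upper : Steps (2 * m) X Z
  upper with distance⇒offsets α β j (+ p) ∣x∣≡m
  ... | inj₁ β+m≡α+jp = steps-sym (steps-upper-bound {P = P} facZ facX |Z| |X| m≤n j β+m≡α+jp)
  ... | inj₂ α+m≡β-jp = steps-upper-bound {P = P} facX facZ |X| |Z| m≤n (- j) α+m≡β-jp
  lower : ∀ k → Steps k X Z → 2 * m ≤ k
  lower k st with p ≤? k
  ... | yes p≤k = ≤-trans 2m≤p p≤k
  ... | no  p≰k with steps-lower-bound {P = P} prim facX facZ (trans |X| (sym |Z|)) (subst (p * p ≤_) (sym |X|) pp) st (≰⇒> p≰k)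
  ...   | t , 2δ≤k = ≤-trans (*-monoʳ-≤ 2 (minimal t)) 2δ≤k

-- Windows of Y

window-start : ∀ K s → - (+ K) ℤ.≤ s → s ℤ.≤ + K → ∃[ α ] + K ℤ.+ s ≡ + α × α ≤ 2 * K
window-start K       (+ a)    _     s≤K = K + a , refl , +-monoʳ-≤ K (≤-trans (ℤ.drop‿+≤+ s≤K) (≤-reflexive (sym (+-identityʳ K))))
window-start zero    -[1+ a ] ()    _
window-start (suc K) -[1+ a ] -K≤s  _   =
  suc K ∸ suc a , ℤ.⊖-≥ (s≤s (ℤ.drop‿-≤- -K≤s)) , ≤-trans (m∸n≤m (suc K) (suc a)) (m≤m+n (suc K) (suc K + 0))

shiftWin-factor : ∀ {P Y : List A} {K n s} .{{_ : NonZero (length P)}} → Periodic Y P → length Y ≡ 2 * K + n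
  → - (+ K) ℤ.≤ s → s ℤ.≤ + K → ∃[ α ] + K ℤ.+ s ≡ + α × length (shiftWin Y K s) ≡ n × FactorAt P α (shiftWin Y K s)
shiftWin-factor {P = P} {Y} {K} {n} {s} per |Y| -K≤s s≤K with window-start K s -K≤s s≤K
... | α , +K+s≡α , α≤2K =
  α , +K+s≡α , subst (λ X → length X ≡ n × FactorAt P α X) (sym window) (factor-substring {P = P} periodic α+n≤|Y|)
  where
  periodic : FactorAt P 0 Y
  periodic i i<|Y| = trans (per i i<|Y|) (cong (P !?_) (mod≡% i (length P)))
  α+n≤|Y| : α + n ≤ length Y
  α+n≤|Y| = subst (α + n ≤_) (sym |Y|) (+-monoˡ-≤ n α≤2K)
  end : (+ length Y ℤ.- + K) ℤ.+ s ≡ + (α + n)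
  end = begin
    (+ length Y ℤ.- + K) ℤ.+ s                   ≡⟨ cong (λ y → (+ y ℤ.- + K) ℤ.+ s) |Y| ⟩
    (+ (2 * K + n) ℤ.- + K) ℤ.+ s                ≡⟨ cong (λ y → (y ℤ.- + K) ℤ.+ s) (trans (ℤ.pos-+ (2 * K) n) (cong (ℤ._+ + n) (ℤ.pos-* 2 K))) ⟩
    ((+ 2 ℤ.* + K ℤ.+ + n) ℤ.- + K) ℤ.+ s        ≡⟨ regroup (+ K) (+ n) s ⟩
    (+ K ℤ.+ s) ℤ.+ + n                          ≡⟨ cong (ℤ._+ + n) +K+s≡α ⟩
    + α ℤ.+ + n                                  ≡⟨ ℤ.pos-+ α n ⟨
    + (α + n)                                    ∎
    where
    open ≡-Reasoning
    regroup : ∀ k n s → ((+ 2 ℤ.* k ℤ.+ n) ℤ.- k) ℤ.+ s ≡ (k ℤ.+ s) ℤ.+ n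
    regroup = solve-∀
  window : shiftWin Y K s ≡ take n (drop α Y)
  window = trans (cong₂ (λ a b → take (b ∸ a) (drop a Y)) (cong ∣_∣ +K+s≡α) (cong ∣_∣ end))
                 (cong (λ l → take l (drop α Y)) (m+n∸m≡n α n))

lemma12 : {A : Set} (Y P : List A) (K : ℕ)
    → Periodic Y P → Primitive P
    → length Y ≥ length P * length P + 2 * K
    → (s s′ : ℤ) → - (+ K) ℤ.≤ s → s ℤ.≤ + K → - (+ K) ℤ.≤ s′ → s′ ℤ.≤ + K
    → ∃[ m ] (IsMinℤ (λ j → ∣ (s ℤ.- s′) ℤ.+ j ℤ.* + length P ∣) m
              × IsED (shiftWin Y K s) (shiftWin Y K s′) (2 * m))
lemma12 Y P K per prim |Y|≥ s s′ -K≤s s≤K -K≤s′ s′≤K =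
  let (α , +K+s≡α , |X| , facX)   = shiftWin-factor {P = P} per |Y| -K≤s s≤K
      (β , +K+s′≡β , |Z| , facZ)  = shiftWin-factor {P = P} per |Y| -K≤s′ s′≤K
      (m , minimal , 2m≤p)        = nearest-multiple (s ℤ.- s′) (length P)
      s-s′≡α-β : s ℤ.- s′ ≡ + α ℤ.- + β
      s-s′≡α-β = trans (difference (+ K) s s′) (cong₂ ℤ._-_ +K+s≡α +K+s′≡β)
  in m , minimal ,
     factors-isED {P = P} prim facX facZ |X| |Z| pp
       (subst (λ d → IsMinℤ (λ j → ∣ d ℤ.+ j ℤ.* + length P ∣) m) s-s′≡α-β minimal) 2m≤p
  where
  instance
    p≢0 : NonZero (length P)
    p≢0 = primitive⇒NonZero {P = P} prim
  ℓ : ℕ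
  ℓ = length Y ∸ 2 * K
  |Y| : length Y ≡ 2 * K + ℓ
  |Y| = sym (m+[n∸m]≡n (m+n≤o⇒n≤o (length P * length P) |Y|≥))
  pp : length P * length P ≤ ℓ
  pp = m+n≤o⇒m≤o∸n (length P * length P) |Y|≥
  difference : ∀ k a b → a ℤ.- b ≡ (k ℤ.+ a) ℤ.- (k ℤ.+ b)
  difference = solve-∀
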